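{- Let $n,m$ be positive integers. There exists a graph $G$ on $n$ vertices having a fooling set of size $m$ if and only if $\mathbf{bp}_{or}(K_m)\le n$.
   Context: For a graph $G$, a fooling set is a set $\mathcal C$ of pairs $(K,S)$ where $K$ is a clique and $S$ a stable set of $G$ (possibly empty) with $K\cap S=\emptyset$, such that for any two distinct pairs $(K,S),(K',S')\in\mathcal C$, $K\cap S'\neq\emptyset$ or $K'\cap S\neq\emptyset$. $K_m$ is the complete graph on $m$ vertices. The oriented bipartite packing $\mathbf{bp}_{or}(H)$ of an undirected graph $H$ is the minimum $k$ such that there exist pairs $(A_1,B_1),\dots,(A_k,B_k)$ of disjoint vertex subsets of $H$ with every vertex of $A_i$ adjacent in $H$ to every vertex of $B_i$ (oriented complete bipartite subgraphs, oriented from $A_i$ to $B_i$), such that for every edge $xy$ of $H$ there is an $i$ with $x\in A_i,y\in B_i$ or $y\in A_i,x\in B_i$, and there is no ordered pair $(x,y)$ and distinct $i\neq j$ with $x\in A_i\cap A_j$ and $y\in B_i\cap B_j$ (each edge is covered at least once, and at most once in each direction). -}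

module Defs where

open import Data.Nat using (ℕ; _≤_)
open import Data.Fin using (Fin; _≟_)
open import Data.Fin.Subset using (Subset; _∈_)
open import Data.Bool using (Bool; true; false; not)
open import Data.Product using (_×_; ∃; ∃-syntax; _,_)
open import Data.Sum using (_⊎_)
open import Relation.Nullary using (¬_; yes; no)
open import Relation.Nullary.Decidable using (⌊_⌋)
open import Relation.Binary.PropositionalEquality using (_≡_; _≢_; refl; sym)

record Graph (n : ℕ) : Set where
  field
    adj    : Fin n → Fin n → Bool
    adj-sym    : ∀ x y → adj x y ≡ adj y x
    adj-irrefl : ∀ x → adj x x ≡ false

open Graph public

Adj : ∀ {n} → Graph n → Fin n → Fin n → Set
Adj G x y = adj G x y ≡ true

private
  symK : ∀ {m} (x y : Fin m) → not ⌊ x ≟ y ⌋ ≡ not ⌊ y ≟ x ⌋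
  symK x y with x ≟ y | y ≟ x
  ... | yes _ | yes _ = refl
  ... | no _  | no _  = refl
  ... | yes p | no q  = Data.Empty.⊥-elim (q (sym p))
    where import Data.Empty
  ... | no p  | yes q = Data.Empty.⊥-elim (p (sym q))
    where import Data.Empty

  irrK : ∀ {m} (x : Fin m) → not ⌊ x ≟ x ⌋ ≡ false
  irrK x with x ≟ x
  ... | yes _ = refl
  ... | no p  = Data.Empty.⊥-elim (p refl)
    where import Data.Empty

complete : (m : ℕ) → Graph m
complete m = record
  { adj = λ x y → not ⌊ x ≟ y ⌋
  ; adj-sym = symK
  ; adj-irrefl = irrK
  }

Meets : ∀ {n} → Subset n → Subset n → Set
Meets A B = ∃[ x ] (x ∈ A × x ∈ B)

Disjoint : ∀ {n} → Subset n → Subset n → Set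
Disjoint A B = ¬ Meets A B

IsClique : ∀ {n} → Graph n → Subset n → Set
IsClique G K = ∀ x y → x ∈ K → y ∈ K → x ≢ y → Adj G x y

IsStable : ∀ {n} → Graph n → Subset n → Set
IsStable G S = ∀ x y → x ∈ S → y ∈ S → ¬ Adj G x y

-- A fooling set of size m in G, given as an indexed family of m pairs (K_i , S_i).
-- (Distinctness of the pairs follows from the fooling condition, since K_i ∩ S_i = ∅.)
FoolingSet : ∀ {n} → Graph n → (m : ℕ) → (Fin m → Subset n × Subset n) → Set
FoolingSet G m C =
  (∀ i → let (K , S) = C i in IsClique G K × IsStable G S × Disjoint K S)
  × (∀ i j → i ≢ j →
       let (K , S) = C i ; (K' , S') = C j in Meets K S' ⊎ Meets K' S)

HasFoolingSet : ∀ {n} → Graph n → ℕ → Set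
HasFoolingSet G m = ∃[ C ] FoolingSet G m C

IsOrientedBipartitePacking : ∀ {n} → Graph n → (k : ℕ) → (Fin k → Subset n × Subset n) → Set
IsOrientedBipartitePacking H k P =
  (∀ i → let (A , B) = P i in
     Disjoint A B × (∀ a b → a ∈ A → b ∈ B → Adj H a b))
  × (∀ x y → Adj H x y → ∃[ i ] let (A , B) = P i in
       (x ∈ A × y ∈ B) ⊎ (y ∈ A × x ∈ B))
  × (∀ x y i j → i ≢ j → let (A , B) = P i ; (A' , B') = P j in
       ¬ (x ∈ A × x ∈ A' × y ∈ B × y ∈ B'))

bpOr≤ : ∀ {v} → Graph v → ℕ → Set
bpOr≤ H n = ∃[ k ] (k ≤ n × ∃[ P ] IsOrientedBipartitePacking H k P)

-- A fooling set (K_i , S_i)_{i<m} of a graph on n vertices and an oriented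
-- bipartite packing of K_m by n pairs are transposes of one incidence
-- structure: vertex v gives the pair A_v = {i : v ∈ K_i}, B_v = {i : v ∈ S_i}.
-- The fooling condition says exactly that every edge ij of K_m is covered.
-- An ordered pair (x , y) covered by two vertices v ≠ w would put v, w in the
-- clique K_x and in the stable set S_y at once. Conversely, a packing (padded
-- with empty pairs up to n) yields a fooling set in the intersection graph of
-- the A_v: K_i is a clique because its vertices share i, and S_i is stable
-- because adjacent t, u ∈ S_i sharing some x ∈ A_t ∩ A_u would cover (x , i)
-- twice.
module Submission where

open import Defs
open import Data.Nat using (ℕ; suc; _≤_; _≤′_; ≤′-reflexive; ≤′-step)
open import Data.Nat.Properties using (≤-refl; ≤⇒≤′)
open import Data.Fin using (Fin; zero; suc; _≟_)
open import Data.Fin.Subset using (Subset; _∈_; _∩_; ⊥)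
open import Data.Fin.Subset.Properties using (∉⊥; x∈p∩q⁺; x∈p∩q⁻; ∩-comm; nonempty?)
open import Data.Vec using (lookup; tabulate)
open import Data.Vec.Properties using (lookup∘tabulate; []=⇒lookup; lookup⇒[]=)
open import Data.Vec.Functional using (_∷_)
open import Data.Bool using (not; _∧_)
open import Data.Bool.Properties using (∧-conicalʳ)
open import Data.Product using (∃-syntax; _×_; _,_; proj₁; proj₂)
open import Data.Sum using (_⊎_; inj₁; inj₂)
open import Function.Bundles using (_⇔_; mk⇔)
open import Relation.Nullary using (¬_; yes; no; contradiction)
open import Relation.Nullary.Decidable using (⌊_⌋)
open import Relation.Binary.PropositionalEquality
  using (_≡_; _≢_; refl; sym; trans; cong; cong₂)

Adj⇒≢ : ∀ {n} (G : Graph n) {x y : Fin n} → Adj G x y → x ≢ y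
Adj⇒≢ G {x} x~x refl = contradiction (trans (sym (adj-irrefl G x)) x~x) λ ()

≢⇒Adj-complete : ∀ {m} {x y : Fin m} → x ≢ y → Adj (complete m) x y
≢⇒Adj-complete {x = x} {y} x≢y with x ≟ y
... | yes x≡y = contradiction x≡y x≢y
... | no _    = refl

intersectionGraph : ∀ {n m} → (Fin n → Subset m) → Graph n
intersectionGraph {n} A = record
  { adj        = λ t u → adj (complete n) t u ∧ ⌊ nonempty? (A t ∩ A u) ⌋
  ; adj-sym    = λ t u → cong₂ _∧_ (adj-sym (complete n) t u)
                                   (cong (λ X → ⌊ nonempty? X ⌋) (∩-comm (A t) (A u)))
  ; adj-irrefl = λ t → cong (_∧ ⌊ nonempty? (A t ∩ A t) ⌋) (adj-irrefl (complete n) t)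
  }

module _ {n m} (A : Fin n → Subset m) where

  Adj-intersectionGraph⁺ : ∀ {t u} → t ≢ u → Meets (A t) (A u) →
                           Adj (intersectionGraph A) t u
  Adj-intersectionGraph⁺ {t} {u} t≢u (x , x∈A-t , x∈A-u) with nonempty? (A t ∩ A u)
  ... | yes _     = cong (_∧ _) (≢⇒Adj-complete t≢u)
  ... | no A-t∩A-u-empty =
    contradiction (x , x∈p∩q⁺ (x∈A-t , x∈A-u)) A-t∩A-u-empty

  Adj-intersectionGraph⁻ : ∀ {t u} → Adj (intersectionGraph A) t u → Meets (A t) (A u)
  Adj-intersectionGraph⁻ {t} {u} t~u with nonempty? (A t ∩ A u)
  ... | yes (x , x∈A-t∩A-u) = x , x∈p∩q⁻ (A t) (A u) x∈A-t∩A-u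
  ... | no _ = contradiction (∧-conicalʳ (adj (complete n) t u) _ t~u) λ ()

transpose : ∀ {m n} → (Fin m → Subset n) → Fin n → Subset m
transpose F v = tabulate λ i → lookup (F i) v

module _ {m n} (F : Fin m → Subset n) {v : Fin n} {i : Fin m} where

  ∈-transpose⁺ : v ∈ F i → i ∈ transpose F v
  ∈-transpose⁺ v∈F-i = lookup⇒[]= i _ (trans (lookup∘tabulate _ i) ([]=⇒lookup v∈F-i))

  ∈-transpose⁻ : i ∈ transpose F v → v ∈ F i
  ∈-transpose⁻ i∈ = lookup⇒[]= v (F i) (trans (sym (lookup∘tabulate _ i)) ([]=⇒lookup i∈))

transposePairs : ∀ {m n} → (Fin m → Subset n × Subset n) → Fin n → Subset m × Subset m
transposePairs C v = transpose (λ i → proj₁ (C i)) v , transpose (λ i → proj₂ (C i)) v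

transposePairs-disjoint : ∀ {m n} {C : Fin m → Subset n × Subset n} →
  (∀ i → Disjoint (proj₁ (C i)) (proj₂ (C i))) →
  ∀ v → Disjoint (proj₁ (transposePairs C v)) (proj₂ (transposePairs C v))
transposePairs-disjoint {C = C} disjoint v (i , i∈A , i∈B) =
  disjoint i (v , ∈-transpose⁻ (λ j → proj₁ (C j)) i∈A , ∈-transpose⁻ (λ j → proj₂ (C j)) i∈B)

module _ {n m} {G : Graph n} {C : Fin m → Subset n × Subset n}
         (fooling : FoolingSet G m C) where

  private
    K S : Fin m → Subset n
    K i = proj₁ (C i)
    S i = proj₂ (C i)
    A B : Fin n → Subset m
    A v = proj₁ (transposePairs C v)
    B v = proj₂ (transposePairs C v)

  foolingSet⇒packing : IsOrientedBipartitePacking (complete m) n (transposePairs C)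
  foolingSet⇒packing = pairs , covered , unique
    where
    disjoint : ∀ v → Disjoint (A v) (B v)
    disjoint = transposePairs-disjoint λ i → proj₂ (proj₂ (proj₁ fooling i))

    pairs : ∀ v → Disjoint (A v) (B v) × (∀ a b → a ∈ A v → b ∈ B v → Adj (complete m) a b)
    pairs v = disjoint v , λ a b a∈ b∈ →
      ≢⇒Adj-complete λ { refl → disjoint v (a , a∈ , b∈) }

    covered : ∀ x y → Adj (complete m) x y →
              ∃[ v ] ((x ∈ A v × y ∈ B v) ⊎ (y ∈ A v × x ∈ B v))
    covered x y x~y with proj₂ fooling x y (Adj⇒≢ (complete m) x~y)
    ... | inj₁ (v , v∈K-x , v∈S-y) = v , inj₁ (∈-transpose⁺ K v∈K-x , ∈-transpose⁺ S v∈S-y)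
    ... | inj₂ (v , v∈K-y , v∈S-x) = v , inj₂ (∈-transpose⁺ K v∈K-y , ∈-transpose⁺ S v∈S-x)

    unique : ∀ x y v w → v ≢ w → ¬ (x ∈ A v × x ∈ A w × y ∈ B v × y ∈ B w)
    unique x y v w v≢w (x∈A-v , x∈A-w , y∈B-v , y∈B-w) =
      proj₁ (proj₂ (proj₁ fooling y)) v w (∈-transpose⁻ S y∈B-v) (∈-transpose⁻ S y∈B-w)
        (proj₁ (proj₁ fooling x) v w (∈-transpose⁻ K x∈A-v) (∈-transpose⁻ K x∈A-w) v≢w)

module _ {n m} {Q : Fin n → Subset m × Subset m}
         (packing : IsOrientedBipartitePacking (complete m) n Q) where

  private
    A B : Fin n → Subset m
    A t = proj₁ (Q t)
    B t = proj₂ (Q t)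
    K S : Fin m → Subset n
    K i = proj₁ (transposePairs Q i)
    S i = proj₂ (transposePairs Q i)

  packing⇒foolingSet : FoolingSet (intersectionGraph A) m (transposePairs Q)
  packing⇒foolingSet = (λ i → clique i , stable i , disjoint i) , fooling
    where
    G : Graph n
    G = intersectionGraph A

    disjoint : ∀ i → Disjoint (K i) (S i)
    disjoint = transposePairs-disjoint {C = Q} λ t → proj₁ (proj₁ packing t)

    clique : ∀ i → IsClique G (K i)
    clique i t u t∈K-i u∈K-i t≢u =
      Adj-intersectionGraph⁺ A t≢u (i , ∈-transpose⁻ A t∈K-i , ∈-transpose⁻ A u∈K-i)

    stable : ∀ i → IsStable G (S i)
    stable i t u t∈S-i u∈S-i t~u =
      let (x , x∈A-t , x∈A-u) = Adj-intersectionGraph⁻ A t~u in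
      proj₂ (proj₂ packing) x i t u (Adj⇒≢ G t~u)
        (x∈A-t , x∈A-u , ∈-transpose⁻ B t∈S-i , ∈-transpose⁻ B u∈S-i)

    fooling : ∀ i j → i ≢ j → Meets (K i) (S j) ⊎ Meets (K j) (S i)
    fooling i j i≢j with proj₁ (proj₂ packing) i j (≢⇒Adj-complete i≢j)
    ... | t , inj₁ (i∈A-t , j∈B-t) = inj₁ (t , ∈-transpose⁺ A i∈A-t , ∈-transpose⁺ B j∈B-t)
    ... | t , inj₂ (j∈A-t , i∈B-t) = inj₂ (t , ∈-transpose⁺ A j∈A-t , ∈-transpose⁺ B i∈B-t)

module _ {n k} {H : Graph n} {P : Fin k → Subset n × Subset n} where

  packing-consEmpty : IsOrientedBipartitePacking H k P →
                      IsOrientedBipartitePacking H (suc k) ((⊥ , ⊥) ∷ P)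
  packing-consEmpty (pairs , covered , unique) = pairs′ , covered′ , unique′
    where
    pairs′ : ∀ i → let (A , B) = ((⊥ , ⊥) ∷ P) i in
             Disjoint A B × (∀ a b → a ∈ A → b ∈ B → Adj H a b)
    pairs′ zero    = (λ (_ , a∈⊥ , _) → ∉⊥ a∈⊥) , λ _ _ a∈⊥ _ → contradiction a∈⊥ ∉⊥
    pairs′ (suc i) = pairs i

    covered′ : ∀ x y → Adj H x y → ∃[ i ] let (A , B) = ((⊥ , ⊥) ∷ P) i in
               (x ∈ A × y ∈ B) ⊎ (y ∈ A × x ∈ B)
    covered′ x y x~y = let (i , x-y-covered) = covered x y x~y in suc i , x-y-covered

    unique′ : ∀ x y i j → i ≢ j → let (A , B) = ((⊥ , ⊥) ∷ P) i ; (A′ , B′) = ((⊥ , ⊥) ∷ P) j in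
              ¬ (x ∈ A × x ∈ A′ × y ∈ B × y ∈ B′)
    unique′ x y zero    _       _   (x∈⊥ , _)     = ∉⊥ x∈⊥
    unique′ x y (suc i) zero    _   (_ , x∈⊥ , _) = ∉⊥ x∈⊥
    unique′ x y (suc i) (suc j) i≢j = unique x y i j λ i≡j → i≢j (cong suc i≡j)

packing-≤′ : ∀ {n k l} {H : Graph n} {P : Fin k → Subset n × Subset n} → k ≤′ l →
             IsOrientedBipartitePacking H k P → ∃[ Q ] IsOrientedBipartitePacking H l Q
packing-≤′ {P = P} (≤′-reflexive refl) packing = P , packing
packing-≤′ {H = H} {P} (≤′-step k≤′l) packing =
  let (Q , packing′) = packing-≤′ {H = H} {P} k≤′l packing
  in (⊥ , ⊥) ∷ Q , packing-consEmpty {H = H} {Q} packing′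

bpOr≤⇒packing : ∀ {v} {H : Graph v} {n} → bpOr≤ H n → ∃[ P ] IsOrientedBipartitePacking H n P
bpOr≤⇒packing {H = H} (k , k≤n , P , packing) = packing-≤′ {H = H} {P} (≤⇒≤′ k≤n) packing

-- The equivalence holds for all n and m.
theorem14 : ∀ (n m : ℕ) → 1 ≤ n → 1 ≤ m →
    (∃[ G ] HasFoolingSet {n} G m) ⇔ bpOr≤ (complete m) n
theorem14 n m _ _ = mk⇔ fooling⇒packing packing⇒fooling
  where
  fooling⇒packing : (∃[ G ] HasFoolingSet {n} G m) → bpOr≤ (complete m) n
  fooling⇒packing (G , C , fooling) =
    n , ≤-refl , transposePairs C , foolingSet⇒packing {G = G} {C = C} fooling

  packing⇒fooling : bpOr≤ (complete m) n → ∃[ G ] HasFoolingSet {n} G m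
  packing⇒fooling bp =
    let (Q , packing) = bpOr≤⇒packing {H = complete m} bp
    in intersectionGraph (λ t → proj₁ (Q t)) , transposePairs Q , packing⇒foolingSet {Q = Q} packing
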